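{- Let $n>2$ be an integer and $r\ge1$ an integer with $2^r+1<2^n$, and let $s_i=(2^r+1)2^{n+i}+1$ for $i\in\mathbb{N}$. Then: (a) $s_{n+l}+s_{n+r}-s_0=\big((2^{n+r}-2^{n+l})+2^{n+1}+4\big)s_0+(2^{n+l}-2^{n}-3)s_1$ for $1\le l\le r$; (b) $s_i+s_n+s_{n+r}-s_0=\big((2^r+1)2^n+2-(2^i-4)\big)s_0+(2^i-4)s_1$ for $2\le i\le n$; (c) $s_1+s_i+s_n+s_{n+r}-s_0=\big((2^r+1)2^n+2-(2^i-4)\big)s_0+(2^i-3)s_1$ for $2\le i\le n$. -}

module Defs where

open import Data.Nat using (ℕ; _+_)
open import Data.Integer using (ℤ; +_; _*_) renaming (_+_ to _+ℤ_; _^_ to _^ℤ_)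

s : ℕ → ℕ → ℕ → ℤ
s n r i = ((+ 2) ^ℤ r +ℤ + 1) * (+ 2) ^ℤ (n + i) +ℤ + 1

-- Writing R = 2^r and N = 2^n, one has s_k = (R + 1)·N·2^k + 1, so once every power 2^(n+k) is
-- split as N·2^k each identity is a polynomial identity in R, N and 2^l (resp. 2^i). The size
-- conditions on n, r, l, i only make the coefficients nonnegative, which the equalities do not need.
{-# OPTIONS --safe #-}
module Submission where

open import Defs
open import Data.Nat using (ℕ; _≤_; _<_) renaming (_+_ to _+ℕ_; _^_ to _^ℕ_)
open import Data.Integer using (ℤ; +_; _+_; _-_; _*_; _^_)
open import Data.Integer.Properties using (^-distribˡ-+-*)
open import Data.Integer.Tactic.RingSolver using (solve-∀)
open import Data.Product using (_×_; _,_)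
open import Relation.Binary.PropositionalEquality using (_≡_; cong)

s-unfold : ∀ n r k → s n r k ≡ ((+ 2) ^ r + + 1) * ((+ 2) ^ n * (+ 2) ^ k) + + 1
s-unfold n r k = cong (λ t → ((+ 2) ^ r + + 1) * t + + 1) (^-distribˡ-+-* (+ 2) n k)

combinationᵃ-polynomial : ∀ R N L →
  ((R + + 1) * (N * (N * L)) + + 1) + ((R + + 1) * (N * (N * R)) + + 1) - ((R + + 1) * (N * + 1) + + 1)
    ≡ ((N * R - N * L) + N * + 2 + + 4) * ((R + + 1) * (N * + 1) + + 1)
      + (N * L - N - + 3) * ((R + + 1) * (N * + 2) + + 1)
combinationᵃ-polynomial = solve-∀

combinationᵇ-polynomial : ∀ R N I →
  ((R + + 1) * (N * I) + + 1) + ((R + + 1) * (N * N) + + 1) + ((R + + 1) * (N * (N * R)) + + 1)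
    - ((R + + 1) * (N * + 1) + + 1)
    ≡ ((R + + 1) * N + + 2 - (I - + 4)) * ((R + + 1) * (N * + 1) + + 1)
      + (I - + 4) * ((R + + 1) * (N * + 2) + + 1)
combinationᵇ-polynomial = solve-∀

combinationᶜ-polynomial : ∀ R N I →
  ((R + + 1) * (N * + 2) + + 1) + ((R + + 1) * (N * I) + + 1) + ((R + + 1) * (N * N) + + 1)
    + ((R + + 1) * (N * (N * R)) + + 1) - ((R + + 1) * (N * + 1) + + 1)
    ≡ ((R + + 1) * N + + 2 - (I - + 4)) * ((R + + 1) * (N * + 1) + + 1)
      + (I - + 3) * ((R + + 1) * (N * + 2) + + 1)
combinationᶜ-polynomial = solve-∀

combinationᵃ : ∀ n r l →
  s n r (n +ℕ l) + s n r (n +ℕ r) - s n r 0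
    ≡ (((+ 2) ^ (n +ℕ r) - (+ 2) ^ (n +ℕ l)) + (+ 2) ^ (n +ℕ 1) + + 4) * s n r 0
      + ((+ 2) ^ (n +ℕ l) - (+ 2) ^ n - + 3) * s n r 1
combinationᵃ n r l
  rewrite s-unfold n r (n +ℕ l) | s-unfold n r (n +ℕ r) | s-unfold n r 0 | s-unfold n r 1
        | ^-distribˡ-+-* (+ 2) n l | ^-distribˡ-+-* (+ 2) n r | ^-distribˡ-+-* (+ 2) n 1
  = combinationᵃ-polynomial ((+ 2) ^ r) ((+ 2) ^ n) ((+ 2) ^ l)

combinationᵇ : ∀ n r i →
  s n r i + s n r n + s n r (n +ℕ r) - s n r 0
    ≡ (((+ 2) ^ r + + 1) * (+ 2) ^ n + + 2 - ((+ 2) ^ i - + 4)) * s n r 0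
      + ((+ 2) ^ i - + 4) * s n r 1
combinationᵇ n r i
  rewrite s-unfold n r i | s-unfold n r n | s-unfold n r (n +ℕ r) | s-unfold n r 0 | s-unfold n r 1
        | ^-distribˡ-+-* (+ 2) n r
  = combinationᵇ-polynomial ((+ 2) ^ r) ((+ 2) ^ n) ((+ 2) ^ i)

combinationᶜ : ∀ n r i →
  s n r 1 + s n r i + s n r n + s n r (n +ℕ r) - s n r 0
    ≡ (((+ 2) ^ r + + 1) * (+ 2) ^ n + + 2 - ((+ 2) ^ i - + 4)) * s n r 0
      + ((+ 2) ^ i - + 3) * s n r 1
combinationᶜ n r i
  rewrite s-unfold n r 1 | s-unfold n r i | s-unfold n r n | s-unfold n r (n +ℕ r) | s-unfold n r 0
        | ^-distribˡ-+-* (+ 2) n r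
  = combinationᶜ-polynomial ((+ 2) ^ r) ((+ 2) ^ n) ((+ 2) ^ i)

lemma8 : (n r : ℕ) → 2 < n → 1 ≤ r → (2 ^ℕ r) +ℕ 1 < 2 ^ℕ n →
    ((l : ℕ) → 1 ≤ l → l ≤ r →
      s n r (n +ℕ l) + s n r (n +ℕ r) - s n r 0
        ≡ (((+ 2) ^ (n +ℕ r) - (+ 2) ^ (n +ℕ l)) + (+ 2) ^ (n +ℕ 1) + + 4) * s n r 0
          + ((+ 2) ^ (n +ℕ l) - (+ 2) ^ n - + 3) * s n r 1)
    × ((i : ℕ) → 2 ≤ i → i ≤ n →
      s n r i + s n r n + s n r (n +ℕ r) - s n r 0
        ≡ (((+ 2) ^ r + + 1) * (+ 2) ^ n + + 2 - ((+ 2) ^ i - + 4)) * s n r 0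
          + ((+ 2) ^ i - + 4) * s n r 1)
    × ((i : ℕ) → 2 ≤ i → i ≤ n →
      s n r 1 + s n r i + s n r n + s n r (n +ℕ r) - s n r 0
        ≡ (((+ 2) ^ r + + 1) * (+ 2) ^ n + + 2 - ((+ 2) ^ i - + 4)) * s n r 0
          + ((+ 2) ^ i - + 3) * s n r 1)
lemma8 n r _ _ _ =
  (λ l _ _ → combinationᵃ n r l) , (λ i _ _ → combinationᵇ n r i) , (λ i _ _ → combinationᶜ n r i)
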